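{- Let $\ell\ge1$, $\sigma\in\mathfrak S_{\ell-1}$, and let $\mathbf q$ be a $\sigma$-twisted MLQ of type $\mathbf m$. Then the type of the word $\mathbf q(1^n)$ is $\mathbf m$.
   Context: Fix $n\ge1$; sites $1,\dots,n$ arranged cyclically. $\mathcal{W}_n$ is the set of words $u=u_1\cdots u_n$ with letters in $\{1,2,\dots\}$; $1^n$ is the all-$1$ word. The type of $u$ is $(m_1,m_2,\dots)$ with $m_i$ the number of letters equal to $i$; $p_i(\mathbf m)=m_1+\cdots+m_i$. A queue is a subset $q\subseteq\{1,\dots,n\}$; an $r$-queue has size $r$. For a queue $q$ and $u$, $v=q(u)$: choose a permutation $(i_1,\dots,i_n)$ of $(1,\dots,n)$ with $u_{i_1}\le\cdots\le u_{i_n}$; Phase I: for $i=i_n,\dots,i_{|q|+1}$ in order, take the first site $j$ weakly to the left of $i$ (cyclically) with $j\notin q$ and $v_j$ unset, set $v_j=u_i+1$; Phase II: for $i=i_1,\dots,i_{|q|}$ in order, take the first site $j$ weakly to the right of $i$ (cyclically) with $j\in q$ and $v_j$ unset, set $v_j=u_i$. For $\sigma\in\mathfrak S_{\ell-1}$, a $\sigma$-twisted MLQ of type $\mathbf m=(m_1,\dots,m_\ell,0,0,\dots)$, where $p_\ell(\mathbf m)=n$, is a sequence $\mathbf q=(q_1,\dots,q_{\ell-1})$ with $q_i$ a $p_{\sigma(i)}(\mathbf m)$-queue; $\mathbf q(u)=q_{\ell-1}(\cdots q_2(q_1(u))\cdots)$. -}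

module Defs where

open import Data.Nat using (ℕ; zero; suc; _+_; _∸_; _≤_; _≟_)
open import Data.Nat.DivMod using (_mod_)
open import Data.Fin using (Fin; toℕ) renaming (_≟_ to _≟ᶠ_)
open import Data.Fin.Subset using (Subset)
open import Data.Bool using (Bool; true; false; not; _∧_; if_then_else_)
open import Data.Maybe using (Maybe; just; nothing; is-nothing)
open import Data.List using (List; []; _∷_; take; drop; reverse; foldl; allFin)
open import Data.List.Relation.Unary.Linked using (Linked)
open import Data.List.Relation.Binary.Permutation.Propositional using (_↭_)
open import Data.Vec using (Vec; lookup)
open import Data.Vec.Functional using (replicate)
open import Data.Product using (Σ; _×_)
open import Relation.Nullary.Decidable using (⌊_⌋)
open import Relation.Binary.PropositionalEquality using (_≡_)

-- A word on n cyclically arranged sites: site j carries the letter (w j).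
Word : ℕ → Set
Word n = Fin n → ℕ

ones : (n : ℕ) → Word n
ones n = replicate n 1

-- cyclic neighbours (sites are Fin n, site 0 = site 1 of the paper, etc.)
-- leftOf i = i - 1 mod n ; rightOf i = i + 1 mod n
leftOf : {n : ℕ} → Fin n → Fin n
leftOf {suc k} i = (toℕ i + k) mod (suc k)

rightOf : {n : ℕ} → Fin n → Fin n
rightOf {suc k} i = (suc (toℕ i)) mod (suc k)

countLetter : {n : ℕ} → Word n → ℕ → ℕ
countLetter {zero} w i = 0
countLetter {suc n} w i =
  (if ⌊ w Fin.zero ≟ i ⌋ then 1 else 0) + countLetter {n} (λ j → w (Fin.suc j)) i

p : {ℓ : ℕ} → ℕ → Vec ℕ ℓ → ℕ
p zero m = 0
p {zero} (suc i) m = 0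
p {suc ℓ} (suc i) (x Data.Vec.∷ m) = x + p i m

-- the type (m_1,...,m_ℓ,0,0,...) as a function of the letter i ≥ 1
-- (value at 0 is irrelevant; set to 0)
extType : {ℓ : ℕ} → Vec ℕ ℓ → ℕ → ℕ
extType m zero = 0
extType {zero} m (suc i) = 0
extType {suc ℓ} (x Data.Vec.∷ m) (suc zero) = x
extType {suc ℓ} (x Data.Vec.∷ m) (suc (suc i)) = extType m (suc i)

HasType : {n ℓ : ℕ} → Word n → Vec ℕ ℓ → Set
HasType w m = ∀ i → 1 ≤ i → countLetter w i ≡ extType m i

_∈q_ : {n : ℕ} → Fin n → Subset n → Bool
j ∈q q = lookup q j

Partial : ℕ → Set
Partial n = Fin n → Maybe ℕ

set : {n : ℕ} → Partial n → Fin n → ℕ → Partial n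
set v j x k = if ⌊ k ≟ᶠ j ⌋ then just x else v k

search : {n : ℕ} → (Fin n → Fin n) → (Fin n → Bool) → ℕ → Fin n → Maybe (Fin n)
search step ok zero i = nothing
search step ok (suc f) i = if ok i then just i else search step ok f (step i)

place : {n : ℕ} → (Fin n → Fin n) → (Fin n → Bool) → Partial n → Fin n → ℕ → Partial n
place {n} step inq v i x with search step (λ j → inq j ∧ is-nothing (v j)) n i
... | nothing = v
... | just j  = set v j x

phaseI : {n : ℕ} → Subset n → Word n → Partial n → List (Fin n) → Partial n
phaseI q u v [] = v
phaseI q u v (i ∷ is) = phaseI q u (place leftOf (λ j → not (j ∈q q)) v i (suc (u i))) is

phaseII : {n : ℕ} → Subset n → Word n → Partial n → List (Fin n) → Partial n
phaseII q u v [] = v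
phaseII q u v (i ∷ is) = phaseII q u (place rightOf (λ j → j ∈q q) v i (u i)) is

fromPartial : {n : ℕ} → Partial n → Word n
fromPartial v j with v j
... | just x  = x
... | nothing = 0

size : {n : ℕ} → Subset n → ℕ
size {zero} q = 0
size {suc n} (b Data.Vec.∷ q) = (if b then 1 else 0) + size q

-- q(u) computed w.r.t. the chosen ordering ord = (i_1,...,i_n):
-- Phase I runs over i_n, ..., i_{|q|+1}; Phase II over i_1, ..., i_{|q|}.
applyQueue : {n : ℕ} → Subset n → Word n → List (Fin n) → Word n
applyQueue q u ord =
  fromPartial (phaseII q u (phaseI q u (λ _ → nothing) (reverse (drop (size q) ord)))
                           (take (size q) ord))

ValidOrder : {n : ℕ} → Word n → List (Fin n) → Set
ValidOrder {n} u ord = (ord ↭ allFin n) × Linked (λ i j → u i ≤ u j) ord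

-- Run qs u w : w is a possible value of q_k(...q_2(q_1(u))...) for
-- qs = q_1,...,q_k (with any admissible choice of permutation at each step)
data Run {n : ℕ} : List (Subset n) → Word n → Word n → Set where
  done : ∀ {u} → Run [] u u
  step : ∀ {q qs u w} (ord : List (Fin n)) → ValidOrder u ord →
         Run qs (applyQueue q u ord) w → Run (q ∷ qs) u w

-- The two phases only decide where letters go. Phase I writes the n − r largest letters, each raised by
-- one, onto the n − r sites outside the queue, Phase II writes the r smallest letters onto the r queue
-- sites, and since every search may run once around the whole cycle, each site is written exactly once.
-- So on the sorted list of letters an r-queue acts as raiseAfter r: keep the r smallest letters and raise
-- the others. These maps commute, hence the twist σ is irrelevant, and raising 1ⁿ after p₁, …, p_{ℓ−1}
-- produces 1^{m₁} 2^{m₂} ⋯ ℓ^{m_ℓ}.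
module Submission where

open import Defs
open import Data.Bool using (Bool; true; false; not; _∧_; if_then_else_)
open import Data.Bool.Properties using (∧-identityʳ; ∧-zeroʳ)
open import Data.Empty using (⊥-elim)
open import Data.Fin as Fin using (Fin; toℕ)
open import Data.Fin.Permutation using (Permutation′; _⟨$⟩ʳ_)
open import Data.Fin.Properties using (toℕ-fromℕ<; toℕ-injective; toℕ<n) renaming (suc-injective to Fin-suc-injective)
open import Data.Fin.Subset using (Subset)
open import Data.List as List using (List; []; _∷_; _++_; length; replicate; take; drop; reverse; tabulate)
open import Data.List.Properties using (++-identityʳ; length-take; length-drop; length-reverse; length-tabulate; map-tabulate; take-map; drop-map; map-∘; tabulate-cong)
open import Data.List.Relation.Unary.Linked as Linked using (Linked; []; [-]; _∷_)
import Data.List.Relation.Unary.Linked.Properties as Linkedₚ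
open import Data.List.Relation.Binary.Permutation.Propositional as ↭ using (_↭_; prep; swap; ↭-sym)
import Data.List.Relation.Binary.Permutation.Propositional.Properties as ↭ₚ
open import Data.Maybe using (Maybe; just; nothing; is-nothing)
open import Data.Nat
open import Data.Nat.DivMod using (_%_; m≤n⇒m%n≡m; [m+n]%n≡m%n; n%n≡0)
open import Data.Nat.GeneralisedArithmetic using (iterate)
open import Data.Nat.Properties
open import Data.Product using (∃-syntax; _×_; _,_; proj₂)
open import Data.Vec as Vec using (Vec; lookup; toList)
open import Function using (_∘_)
open import Relation.Binary.PropositionalEquality
open import Relation.Binary.Definitions using (tri<; tri≈; tri>)
open import Relation.Nullary using (yes; no)
open import Relation.Nullary.Decidable using (⌊_⌋)
import Algebra.Properties.CommutativeMonoid.Sum as MonoidSum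

iterate-+ : {A : Set} (f : A → A) (x : A) (a b : ℕ) → iterate f x (a + b) ≡ iterate f (iterate f x a) b
iterate-+ f x zero b = refl
iterate-+ f x (suc a) b = iterate-+ f (f x) a b

Exhaustive : {n : ℕ} → (Fin n → Fin n) → Set
Exhaustive {n} next = ∀ i j → ∃[ t ] t < n × iterate next i t ≡ j

toℕ-leftOf-suc : ∀ {k} (i : Fin (suc k)) a → toℕ i ≡ suc a → toℕ (leftOf i) ≡ a
toℕ-leftOf-suc {k} i a i≡1+a = begin
  toℕ (leftOf i)       ≡⟨ toℕ-fromℕ< _ ⟩
  (toℕ i + k) % suc k  ≡⟨ cong (λ z → (z + k) % suc k) i≡1+a ⟩
  (suc a + k) % suc k  ≡⟨ cong (_% suc k) (sym (+-suc a k)) ⟩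
  (a + suc k) % suc k  ≡⟨ [m+n]%n≡m%n a (suc k) ⟩
  a % suc k            ≡⟨ m≤n⇒m%n≡m (<⇒≤ (s<s⁻¹ (subst (_< suc k) i≡1+a (toℕ<n i)))) ⟩
  a                    ∎
  where open ≡-Reasoning

toℕ-leftOf-zero : ∀ {k} (i : Fin (suc k)) → toℕ i ≡ 0 → toℕ (leftOf i) ≡ k
toℕ-leftOf-zero {k} i i≡0 = begin
  toℕ (leftOf i)       ≡⟨ toℕ-fromℕ< _ ⟩
  (toℕ i + k) % suc k  ≡⟨ cong (λ z → (z + k) % suc k) i≡0 ⟩
  k % suc k            ≡⟨ m≤n⇒m%n≡m ≤-refl ⟩
  k                    ∎
  where open ≡-Reasoning

toℕ-iterate-leftOf : ∀ {k} (i : Fin (suc k)) t a → toℕ i ≡ t + a → toℕ (iterate leftOf i t) ≡ a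
toℕ-iterate-leftOf i zero a i≡a = i≡a
toℕ-iterate-leftOf i (suc t) a i≡1+t+a =
  toℕ-iterate-leftOf (leftOf i) t a (toℕ-leftOf-suc i (t + a) i≡1+t+a)

leftOf-exhaustive : ∀ {n} → Exhaustive (leftOf {n})
leftOf-exhaustive {suc k} i j with toℕ j ≤? toℕ i
... | yes j≤i = toℕ i ∸ toℕ j , s≤s (≤-trans (m∸n≤m (toℕ i) (toℕ j)) (≤-pred (toℕ<n i))) ,
      toℕ-injective (toℕ-iterate-leftOf i (toℕ i ∸ toℕ j) (toℕ j) (sym (m∸n+n≡m j≤i)))
... | no j≰i = toℕ i + suc (k ∸ toℕ j) , s≤s t≤k , toℕ-injective reaches-j
  where
  j≤k : toℕ j ≤ k
  j≤k = ≤-pred (toℕ<n j)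
  at-zero : toℕ (iterate leftOf i (toℕ i)) ≡ 0
  at-zero = toℕ-iterate-leftOf i (toℕ i) 0 (sym (+-identityʳ _))
  t≤k : toℕ i + suc (k ∸ toℕ j) ≤ k
  t≤k = begin
    toℕ i + suc (k ∸ toℕ j)    ≡⟨ +-suc (toℕ i) _ ⟩
    suc (toℕ i) + (k ∸ toℕ j)  ≤⟨ +-monoˡ-≤ (k ∸ toℕ j) (≰⇒> j≰i) ⟩
    toℕ j + (k ∸ toℕ j)        ≡⟨ m+[n∸m]≡n j≤k ⟩
    k                          ∎
    where open ≤-Reasoning
  reaches-j : toℕ (iterate leftOf i (toℕ i + suc (k ∸ toℕ j))) ≡ toℕ j
  reaches-j = begin
    toℕ (iterate leftOf i (toℕ i + suc (k ∸ toℕ j)))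
      ≡⟨ cong toℕ (iterate-+ leftOf i (toℕ i) (suc (k ∸ toℕ j))) ⟩
    toℕ (iterate leftOf (leftOf (iterate leftOf i (toℕ i))) (k ∸ toℕ j))
      ≡⟨ toℕ-iterate-leftOf _ (k ∸ toℕ j) (toℕ j) (trans (toℕ-leftOf-zero _ at-zero) (sym (m∸n+n≡m j≤k))) ⟩
    toℕ j ∎
    where open ≡-Reasoning

toℕ-rightOf-< : ∀ {k} (i : Fin (suc k)) → toℕ i < k → toℕ (rightOf i) ≡ suc (toℕ i)
toℕ-rightOf-< i i<k = trans (toℕ-fromℕ< _) (m≤n⇒m%n≡m i<k)

toℕ-rightOf-last : ∀ {k} (i : Fin (suc k)) → toℕ i ≡ k → toℕ (rightOf i) ≡ 0
toℕ-rightOf-last {k} i i≡k = trans (toℕ-fromℕ< _) (trans (cong (λ z → suc z % suc k) i≡k) (n%n≡0 (suc k)))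

toℕ-iterate-rightOf : ∀ {k} (i : Fin (suc k)) t → toℕ i + t ≤ k → toℕ (iterate rightOf i t) ≡ toℕ i + t
toℕ-iterate-rightOf i zero _ = sym (+-identityʳ _)
toℕ-iterate-rightOf {k} i (suc t) i+1+t≤k = begin
  toℕ (iterate rightOf (rightOf i) t) ≡⟨ toℕ-iterate-rightOf (rightOf i) t (subst (λ z → z + t ≤ k) (sym next) i+1+t≤k′) ⟩
  toℕ (rightOf i) + t                 ≡⟨ cong (_+ t) next ⟩
  suc (toℕ i) + t                     ≡⟨ sym (+-suc (toℕ i) t) ⟩
  toℕ i + suc t                       ∎
  where
  open ≡-Reasoning
  i+1+t≤k′ : suc (toℕ i) + t ≤ k
  i+1+t≤k′ = subst (_≤ k) (+-suc (toℕ i) t) i+1+t≤k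
  next : toℕ (rightOf i) ≡ suc (toℕ i)
  next = toℕ-rightOf-< i (≤-trans (s≤s (m≤m+n (toℕ i) t)) i+1+t≤k′)

rightOf-exhaustive : ∀ {n} → Exhaustive (rightOf {n})
rightOf-exhaustive {suc k} i j with toℕ i ≤? toℕ j
... | yes i≤j = toℕ j ∸ toℕ i , s≤s (≤-trans (m∸n≤m (toℕ j) (toℕ i)) j≤k) ,
      toℕ-injective (trans (toℕ-iterate-rightOf i (toℕ j ∸ toℕ i) (subst (_≤ k) (sym (m+[n∸m]≡n i≤j)) j≤k))
                           (m+[n∸m]≡n i≤j))
  where
  j≤k : toℕ j ≤ k
  j≤k = ≤-pred (toℕ<n j)
... | no i≰j = (k ∸ toℕ i) + suc (toℕ j) , s≤s t≤k , toℕ-injective reaches-j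
  where
  i≤k : toℕ i ≤ k
  i≤k = ≤-pred (toℕ<n i)
  at-zero : toℕ (rightOf (iterate rightOf i (k ∸ toℕ i))) ≡ 0
  at-zero = toℕ-rightOf-last _ (trans (toℕ-iterate-rightOf i (k ∸ toℕ i) (≤-reflexive (m+[n∸m]≡n i≤k)))
                                      (m+[n∸m]≡n i≤k))
  t≤k : (k ∸ toℕ i) + suc (toℕ j) ≤ k
  t≤k = begin
    (k ∸ toℕ i) + suc (toℕ j)  ≤⟨ +-monoʳ-≤ (k ∸ toℕ i) (≰⇒> i≰j) ⟩
    (k ∸ toℕ i) + toℕ i        ≡⟨ m∸n+n≡m i≤k ⟩
    k                          ∎
    where open ≤-Reasoning
  reaches-j : toℕ (iterate rightOf i ((k ∸ toℕ i) + suc (toℕ j))) ≡ toℕ j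
  reaches-j = begin
    toℕ (iterate rightOf i ((k ∸ toℕ i) + suc (toℕ j)))
      ≡⟨ cong toℕ (iterate-+ rightOf i (k ∸ toℕ i) (suc (toℕ j))) ⟩
    toℕ (iterate rightOf (rightOf (iterate rightOf i (k ∸ toℕ i))) (toℕ j))
      ≡⟨ toℕ-iterate-rightOf _ (toℕ j) (subst (λ z → z + toℕ j ≤ k) (sym at-zero) (≤-pred (toℕ<n j))) ⟩
    toℕ (rightOf (iterate rightOf i (k ∸ toℕ i))) + toℕ j
      ≡⟨ cong (_+ toℕ j) at-zero ⟩
    toℕ j ∎
    where open ≡-Reasoning

indicator : Bool → ℕ
indicator b = if b then 1 else 0

count : {n : ℕ} → (Fin n → Bool) → ℕ
count {zero} f = 0
count {suc n} f = indicator (f Fin.zero) + count (f ∘ Fin.suc)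

count-cong : ∀ {n} {f g : Fin n → Bool} → (∀ k → f k ≡ g k) → count f ≡ count g
count-cong {zero} f≗g = refl
count-cong {suc n} f≗g = cong₂ _+_ (cong indicator (f≗g Fin.zero)) (count-cong (f≗g ∘ Fin.suc))

count-update : ∀ {n} (f g : Fin n → Bool) j → (∀ k → k ≢ j → f k ≡ g k) →
  count f + indicator (g j) ≡ count g + indicator (f j)
count-update {suc n} f g Fin.zero f≗g = begin
  indicator (f Fin.zero) + count (f ∘ Fin.suc) + indicator (g Fin.zero)
    ≡⟨ cong (λ c → indicator (f Fin.zero) + c + indicator (g Fin.zero)) (count-cong (λ k → f≗g (Fin.suc k) (λ ()))) ⟩
  indicator (f Fin.zero) + count (g ∘ Fin.suc) + indicator (g Fin.zero)
    ≡⟨ +-comm (indicator (f Fin.zero) + _) _ ⟩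
  indicator (g Fin.zero) + (indicator (f Fin.zero) + count (g ∘ Fin.suc))
    ≡⟨ cong (indicator (g Fin.zero) +_) (+-comm (indicator (f Fin.zero)) _) ⟩
  indicator (g Fin.zero) + (count (g ∘ Fin.suc) + indicator (f Fin.zero))
    ≡⟨ sym (+-assoc (indicator (g Fin.zero)) _ _) ⟩
  indicator (g Fin.zero) + count (g ∘ Fin.suc) + indicator (f Fin.zero) ∎
  where open ≡-Reasoning
count-update {suc n} f g (Fin.suc j) f≗g = begin
  indicator (f Fin.zero) + count (f ∘ Fin.suc) + indicator (g (Fin.suc j))
    ≡⟨ +-assoc (indicator (f Fin.zero)) _ _ ⟩
  indicator (f Fin.zero) + (count (f ∘ Fin.suc) + indicator (g (Fin.suc j)))
    ≡⟨ cong₂ _+_ (cong indicator (f≗g Fin.zero (λ ())))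
                 (count-update (f ∘ Fin.suc) (g ∘ Fin.suc) j (λ k k≢j → f≗g (Fin.suc k) (k≢j ∘ Fin-suc-injective))) ⟩
  indicator (g Fin.zero) + (count (g ∘ Fin.suc) + indicator (f (Fin.suc j)))
    ≡⟨ sym (+-assoc (indicator (g Fin.zero)) _ _) ⟩
  indicator (g Fin.zero) + count (g ∘ Fin.suc) + indicator (f (Fin.suc j)) ∎
  where open ≡-Reasoning

count-pos⇒∃ : ∀ {n} (f : Fin n → Bool) → 1 ≤ count f → ∃[ j ] f j ≡ true
count-pos⇒∃ {suc n} f pos with f Fin.zero in f0
... | true = Fin.zero , f0
... | false with count-pos⇒∃ (f ∘ Fin.suc) pos
... | j , fj = Fin.suc j , fj

count≡0⇒false : ∀ {n} (f : Fin n → Bool) → count f ≡ 0 → ∀ j → f j ≡ false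
count≡0⇒false f none Fin.zero with f Fin.zero
... | false = refl
count≡0⇒false f none (Fin.suc j) =
  count≡0⇒false (f ∘ Fin.suc) (m+n≡0⇒n≡0 (indicator (f Fin.zero)) none) j

count-false : ∀ n → count {n} (λ _ → false) ≡ 0
count-false zero = refl
count-false (suc n) = count-false n

count+count-not : ∀ {n} (f : Fin n → Bool) → count f + count (not ∘ f) ≡ n
count+count-not {zero} f = refl
count+count-not {suc n} f with f Fin.zero
... | true = cong suc (count+count-not (f ∘ Fin.suc))
... | false = trans (+-suc (count (f ∘ Fin.suc)) _) (cong suc (count+count-not (f ∘ Fin.suc)))

size≡count : ∀ {n} (q : Subset n) → size q ≡ count (lookup q)
size≡count Vec.[] = refl
size≡count (b Vec.∷ q) = cong (indicator b +_) (size≡count q)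

countLetter≡count : ∀ {n} (w : Word n) y → countLetter w y ≡ count (λ j → ⌊ w j ≟ y ⌋)
countLetter≡count {zero} w y = refl
countLetter≡count {suc n} w y = cong (indicator ⌊ w Fin.zero ≟ y ⌋ +_) (countLetter≡count (w ∘ Fin.suc) y)

holds : ℕ → Maybe ℕ → Bool
holds y (just x) = ⌊ x ≟ y ⌋
holds y nothing = false

occurrences : {n : ℕ} → Partial n → ℕ → ℕ
occurrences v y = count (λ k → holds y (v k))

vacant : {n : ℕ} → (Fin n → Bool) → Partial n → Fin n → Bool
vacant admissible v k = admissible k ∧ is-nothing (v k)

vacancies : {n : ℕ} → (Fin n → Bool) → Partial n → ℕ
vacancies admissible v = count (vacant admissible v)

set-≡ : ∀ {n} (v : Partial n) j x → set v j x j ≡ just x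
set-≡ v j x with j Fin.≟ j
... | yes _ = refl
... | no j≢j = ⊥-elim (j≢j refl)

set-≢ : ∀ {n} (v : Partial n) j x k → k ≢ j → set v j x k ≡ v k
set-≢ v j x k k≢j with k Fin.≟ j
... | yes k≡j = ⊥-elim (k≢j k≡j)
... | no _ = refl

count-set : ∀ {n} (P : Fin n → Maybe ℕ → Bool) (v : Partial n) j x →
  count (λ k → P k (set v j x k)) + indicator (P j (v j)) ≡ count (λ k → P k (v k)) + indicator (P j (just x))
count-set P v j x =
  trans (count-update (λ k → P k (set v j x k)) (λ k → P k (v k)) j (λ k k≢j → cong (P k) (set-≢ v j x k k≢j)))
        (cong (λ z → count (λ k → P k (v k)) + indicator (P j z)) (set-≡ v j x))

vacant⇒unset : ∀ {n} (admissible : Fin n → Bool) (v : Partial n) j → vacant admissible v j ≡ true → v j ≡ nothing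
vacant⇒unset admissible v j vac with admissible j | v j | vac
... | true | nothing | _ = refl
... | true | just _ | ()
... | false | _ | ()

vacant⇒admissible : ∀ {n} (admissible : Fin n → Bool) (v : Partial n) j → vacant admissible v j ≡ true → admissible j ≡ true
vacant⇒admissible admissible v j vac with admissible j | vac
... | true | _ = refl
... | false | ()

Disjoint : {n : ℕ} → (Fin n → Bool) → (Fin n → Bool) → Set
Disjoint A B = ∀ k → A k ≡ true → B k ≡ false

module _ {n : ℕ} (admissible : Fin n → Bool) (v : Partial n) {j : Fin n} (x : ℕ)
         (j-vacant : vacant admissible v j ≡ true) where

  vacancies-set : vacancies admissible (set v j x) + 1 ≡ vacancies admissible v
  vacancies-set = begin
    vacancies admissible (set v j x) + 1
      ≡⟨ cong (λ b → vacancies admissible (set v j x) + indicator b) (sym j-vacant) ⟩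
    vacancies admissible (set v j x) + indicator (vacant admissible v j)
      ≡⟨ count-set (λ k m → admissible k ∧ is-nothing m) v j x ⟩
    vacancies admissible v + indicator (admissible j ∧ false)
      ≡⟨ cong (λ b → vacancies admissible v + indicator b) (∧-zeroʳ (admissible j)) ⟩
    vacancies admissible v + 0
      ≡⟨ +-identityʳ _ ⟩
    vacancies admissible v ∎
    where open ≡-Reasoning

  occurrences-set : ∀ y → occurrences (set v j x) y ≡ occurrences v y + indicator ⌊ x ≟ y ⌋
  occurrences-set y = begin
    occurrences (set v j x) y                         ≡⟨ sym (+-identityʳ _) ⟩
    occurrences (set v j x) y + 0                     ≡⟨ cong (λ m → occurrences (set v j x) y + indicator (holds y m))
                                                              (sym (vacant⇒unset admissible v j j-vacant)) ⟩
    occurrences (set v j x) y + indicator (holds y (v j)) ≡⟨ count-set (λ k → holds y) v j x ⟩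
    occurrences v y + indicator ⌊ x ≟ y ⌋             ∎
    where open ≡-Reasoning

  vacancies-set-disjoint : ∀ other → Disjoint admissible other →
    vacancies other (set v j x) ≡ vacancies other v
  vacancies-set-disjoint other disjoint = begin
    vacancies other (set v j x)                         ≡⟨ sym (+-identityʳ _) ⟩
    vacancies other (set v j x) + indicator (false ∧ is-nothing (v j))
      ≡⟨ cong (λ b → vacancies other (set v j x) + indicator (b ∧ is-nothing (v j))) (sym other[j]) ⟩
    vacancies other (set v j x) + indicator (vacant other v j)
      ≡⟨ count-set (λ k m → other k ∧ is-nothing m) v j x ⟩
    vacancies other v + indicator (other j ∧ false)
      ≡⟨ cong (λ b → vacancies other v + indicator b) (∧-zeroʳ (other j)) ⟩
    vacancies other v + 0                               ≡⟨ +-identityʳ _ ⟩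
    vacancies other v                                   ∎
    where
    open ≡-Reasoning
    other[j] : other j ≡ false
    other[j] = disjoint j (vacant⇒admissible admissible v j j-vacant)

search-just : ∀ {n} (next : Fin n → Fin n) ok fuel i j → search next ok fuel i ≡ just j → ok j ≡ true
search-just next ok (suc fuel) i j found with ok i in ok[i]
search-just next ok (suc fuel) i .i refl | true = ok[i]
... | false = search-just next ok fuel (next i) j found

search-nothing : ∀ {n} (next : Fin n → Fin n) ok fuel i → search next ok fuel i ≡ nothing →
  ∀ t → t < fuel → ok (iterate next i t) ≡ false
search-nothing next ok (suc fuel) i missed t t<fuel with ok i in ok[i]
search-nothing next ok (suc fuel) i () t t<fuel | true
search-nothing next ok (suc fuel) i missed zero t<fuel | false = ok[i]
search-nothing next ok (suc fuel) i missed (suc t) (s≤s t<fuel) | false =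
  search-nothing next ok fuel (next i) missed t t<fuel

place-fills-vacancy : ∀ {n} (next : Fin n → Fin n) → Exhaustive next →
  ∀ admissible (v : Partial n) i x → 1 ≤ vacancies admissible v →
  ∃[ j ] vacant admissible v j ≡ true × place next admissible v i x ≡ set v j x
place-fills-vacancy {n} next exhaustive admissible v i x some-vacant
  with search next (λ j → admissible j ∧ is-nothing (v j)) n i in found
... | just j = j , search-just next _ n i j found , refl
... | nothing with count-pos⇒∃ (vacant admissible v) some-vacant
... | j , j-vacant with exhaustive i j
... | t , t<n , reaches-j with search-nothing next _ n i found t t<n
... | not-vacant rewrite reaches-j with () ← trans (sym j-vacant) not-vacant

mult : List ℕ → ℕ → ℕ
mult [] y = 0
mult (a ∷ as) y = indicator ⌊ a ≟ y ⌋ + mult as y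

phase : {n : ℕ} → (Fin n → Fin n) → (Fin n → Bool) → (Fin n → ℕ) → Partial n → List (Fin n) → Partial n
phase next admissible g v [] = v
phase next admissible g v (i ∷ is) = phase next admissible g (place next admissible v i (g i)) is

phaseI≡phase : ∀ {n} (q : Subset n) u (v : Partial n) is →
  phaseI q u v is ≡ phase leftOf (not ∘ lookup q) (suc ∘ u) v is
phaseI≡phase q u v [] = refl
phaseI≡phase q u v (i ∷ is) = phaseI≡phase q u _ is

phaseII≡phase : ∀ {n} (q : Subset n) u (v : Partial n) is → phaseII q u v is ≡ phase rightOf (lookup q) u v is
phaseII≡phase q u v [] = refl
phaseII≡phase q u v (i ∷ is) = phaseII≡phase q u _ is

module _ {n : ℕ} (next : Fin n → Fin n) (exhaustive : Exhaustive next)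
         (admissible : Fin n → Bool) (g : Fin n → ℕ) where

  private
    place-next : ∀ v i (is : List (Fin n)) → suc (length is) ≡ vacancies admissible v →
      ∃[ j ] vacant admissible v j ≡ true × place next admissible v i (g i) ≡ set v j (g i)
             × length is ≡ vacancies admissible (set v j (g i))
    place-next v i is fits with place-fills-vacancy next exhaustive admissible v i (g i) (≤-trans (s≤s z≤n) (≤-reflexive fits))
    ... | j , j-vacant , placed =
      j , j-vacant , placed , suc-injective (trans fits (trans (sym (vacancies-set admissible v (g i) j-vacant)) (+-comm _ 1)))

  phase-fills-vacancies : ∀ v (is : List (Fin n)) → length is ≡ vacancies admissible v →
    vacancies admissible (phase next admissible g v is) ≡ 0
  phase-fills-vacancies v [] fits = sym fits
  phase-fills-vacancies v (i ∷ is) fits with place-next v i is fits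
  ... | j , _ , placed , fits′ rewrite placed = phase-fills-vacancies (set v j (g i)) is fits′

  phase-occurrences : ∀ v (is : List (Fin n)) → length is ≡ vacancies admissible v → ∀ y →
    occurrences (phase next admissible g v is) y ≡ occurrences v y + mult (List.map g is) y
  phase-occurrences v [] fits y = sym (+-identityʳ _)
  phase-occurrences v (i ∷ is) fits y with place-next v i is fits
  ... | j , j-vacant , placed , fits′ rewrite placed = begin
    occurrences (phase next admissible g (set v j (g i)) is) y
      ≡⟨ phase-occurrences (set v j (g i)) is fits′ y ⟩
    occurrences (set v j (g i)) y + mult (List.map g is) y
      ≡⟨ cong (_+ mult (List.map g is) y) (occurrences-set admissible v (g i) j-vacant y) ⟩
    occurrences v y + indicator ⌊ g i ≟ y ⌋ + mult (List.map g is) y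
      ≡⟨ +-assoc (occurrences v y) _ _ ⟩
    occurrences v y + mult (List.map g (i ∷ is)) y ∎
    where open ≡-Reasoning

  phase-vacancies-disjoint : ∀ other → Disjoint admissible other → ∀ v (is : List (Fin n)) → length is ≡ vacancies admissible v →
    vacancies other (phase next admissible g v is) ≡ vacancies other v
  phase-vacancies-disjoint other disjoint v [] fits = refl
  phase-vacancies-disjoint other disjoint v (i ∷ is) fits with place-next v i is fits
  ... | j , j-vacant , placed , fits′ rewrite placed =
    trans (phase-vacancies-disjoint other disjoint (set v j (g i)) is fits′)
          (vacancies-set-disjoint admissible v (g i) j-vacant other disjoint)

countLetter-fromPartial : ∀ {n} (v : Partial n) → (∀ j → is-nothing (v j) ≡ false) →
  ∀ y → countLetter (fromPartial v) y ≡ occurrences v y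
countLetter-fromPartial v filled y = trans (countLetter≡count (fromPartial v) y) (count-cong agree)
  where
  agree : ∀ j → ⌊ fromPartial v j ≟ y ⌋ ≡ holds y (v j)
  agree j with v j | filled j
  ... | just x | _ = refl

no-vacancies⇒filled : ∀ {n} (admissible : Fin n → Bool) (v : Partial n) →
  vacancies admissible v ≡ 0 → vacancies (not ∘ admissible) v ≡ 0 → ∀ j → is-nothing (v j) ≡ false
no-vacancies⇒filled admissible v none-in none-out j with admissible j in j-in
... | true = subst (λ b → b ∧ is-nothing (v j) ≡ false) j-in (count≡0⇒false _ none-in j)
... | false = subst (λ b → not b ∧ is-nothing (v j) ≡ false) j-in (count≡0⇒false _ none-out j)

vacancies-empty : ∀ {n} (admissible : Fin n → Bool) → vacancies admissible (λ _ → nothing) ≡ count admissible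
vacancies-empty admissible = count-cong (∧-identityʳ ∘ admissible)

complement-disjointˡ : ∀ {n} (A : Fin n → Bool) → Disjoint (not ∘ A) A
complement-disjointˡ A k k-out with A k | k-out
... | false | _ = refl

complement-disjointʳ : ∀ {n} (A : Fin n → Bool) → Disjoint A (not ∘ A)
complement-disjointʳ A k k-in rewrite k-in = refl

two-phases-countLetter : ∀ {n} (inside : Fin n → Bool) (g h : Fin n → ℕ) (late early : List (Fin n)) →
  length late ≡ count (not ∘ inside) → length early ≡ count inside → ∀ y →
  countLetter (fromPartial (phase rightOf inside h (phase leftOf (not ∘ inside) g (λ _ → nothing) late) early)) y
    ≡ mult (List.map g late) y + mult (List.map h early) y
two-phases-countLetter {n} inside g h late early |late| |early| y = begin
  countLetter (fromPartial v₂) y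
    ≡⟨ countLetter-fromPartial v₂ (no-vacancies⇒filled inside v₂ inside-filled outside-filled) y ⟩
  occurrences v₂ y
    ≡⟨ phase-occurrences rightOf rightOf-exhaustive inside h v₁ early early-fits y ⟩
  occurrences v₁ y + mult (List.map h early) y
    ≡⟨ cong (_+ mult (List.map h early) y) (phase-occurrences leftOf leftOf-exhaustive outside g v₀ late late-fits y) ⟩
  occurrences v₀ y + mult (List.map g late) y + mult (List.map h early) y
    ≡⟨ cong (λ c → c + mult (List.map g late) y + mult (List.map h early) y) (count-false n) ⟩
  mult (List.map g late) y + mult (List.map h early) y ∎
  where
  open ≡-Reasoning
  outside : Fin n → Bool
  outside = not ∘ inside
  v₀ v₁ v₂ : Partial n
  v₀ = λ _ → nothing
  v₁ = phase leftOf outside g v₀ late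
  v₂ = phase rightOf inside h v₁ early
  late-fits : length late ≡ vacancies outside v₀
  late-fits = trans |late| (sym (vacancies-empty outside))
  early-fits : length early ≡ vacancies inside v₁
  early-fits = trans |early| (trans (sym (vacancies-empty inside))
    (sym (phase-vacancies-disjoint leftOf leftOf-exhaustive outside g inside (complement-disjointˡ inside) v₀ late late-fits)))
  inside-filled : vacancies inside v₂ ≡ 0
  inside-filled = phase-fills-vacancies rightOf rightOf-exhaustive inside h v₁ early early-fits
  outside-filled : vacancies outside v₂ ≡ 0
  outside-filled = trans
    (phase-vacancies-disjoint rightOf rightOf-exhaustive inside h outside (complement-disjointʳ inside) v₁ early early-fits)
    (phase-fills-vacancies leftOf leftOf-exhaustive outside g v₀ late late-fits)

applyQueue-countLetter : ∀ {n} (q : Subset n) (u : Word n) ord → length ord ≡ n → ∀ y →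
  countLetter (applyQueue q u ord) y ≡
    mult (List.map (suc ∘ u) (reverse (drop (size q) ord))) y + mult (List.map u (take (size q) ord)) y
applyQueue-countLetter {n} q u ord |ord|≡n y
  rewrite phaseII≡phase q u (phaseI q u (λ _ → nothing) (reverse (drop (size q) ord))) (take (size q) ord)
        | phaseI≡phase q u (λ _ → nothing) (reverse (drop (size q) ord))
  = two-phases-countLetter (lookup q) (suc ∘ u) u (reverse (drop r ord)) (take r ord) |late| |early| y
  where
  open ≡-Reasoning
  r = size q
  count-inside : count (lookup q) ≡ r
  count-inside = sym (size≡count q)
  count-outside : count (not ∘ lookup q) ≡ n ∸ r
  count-outside = trans (sym (m+n∸m≡n r _))
    (cong (_∸ r) (trans (cong (_+ count (not ∘ lookup q)) (sym count-inside)) (count+count-not (lookup q))))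
  r≤n : r ≤ n
  r≤n = subst (_≤ n) count-inside (subst (count (lookup q) ≤_) (count+count-not (lookup q)) (m≤m+n _ _))
  |late| : length (reverse (drop r ord)) ≡ count (not ∘ lookup q)
  |late| = begin
    length (reverse (drop r ord))  ≡⟨ length-reverse (drop r ord) ⟩
    length (drop r ord)            ≡⟨ length-drop r ord ⟩
    length ord ∸ r                 ≡⟨ cong (_∸ r) |ord|≡n ⟩
    n ∸ r                          ≡⟨ sym count-outside ⟩
    count (not ∘ lookup q)         ∎
  |early| : length (take r ord) ≡ count (lookup q)
  |early| = begin
    length (take r ord)  ≡⟨ length-take r ord ⟩
    r ⊓ length ord       ≡⟨ cong (r ⊓_) |ord|≡n ⟩
    r ⊓ n                ≡⟨ m≤n⇒m⊓n≡m r≤n ⟩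
    r                    ≡⟨ sym count-inside ⟩
    count (lookup q)     ∎

Sorted : List ℕ → Set
Sorted = Linked _≤_

mult-++ : ∀ xs ys y → mult (xs ++ ys) y ≡ mult xs y + mult ys y
mult-++ [] ys y = refl
mult-++ (a ∷ xs) ys y = trans (cong (indicator ⌊ a ≟ y ⌋ +_) (mult-++ xs ys y)) (sym (+-assoc (indicator ⌊ a ≟ y ⌋) _ _))

mult-↭ : ∀ {xs ys} → xs ↭ ys → ∀ y → mult xs y ≡ mult ys y
mult-↭ ↭.refl y = refl
mult-↭ (prep a xs↭ys) y = cong (indicator ⌊ a ≟ y ⌋ +_) (mult-↭ xs↭ys y)
mult-↭ (swap {xs} {ys} a b xs↭ys) y = begin
  [a] + ([b] + mult xs y)  ≡⟨ sym (+-assoc [a] [b] _) ⟩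
  [a] + [b] + mult xs y    ≡⟨ cong (_+ mult xs y) (+-comm [a] [b]) ⟩
  [b] + [a] + mult xs y    ≡⟨ +-assoc [b] [a] _ ⟩
  [b] + ([a] + mult xs y)  ≡⟨ cong (λ c → [b] + ([a] + c)) (mult-↭ xs↭ys y) ⟩
  [b] + ([a] + mult ys y)  ∎
  where
  open ≡-Reasoning
  [a] [b] : ℕ
  [a] = indicator ⌊ a ≟ y ⌋
  [b] = indicator ⌊ b ≟ y ⌋
mult-↭ (↭.trans xs↭ys ys↭zs) y = trans (mult-↭ xs↭ys y) (mult-↭ ys↭zs y)

countLetter≡mult-tabulate : ∀ {n} (u : Word n) y → countLetter u y ≡ mult (tabulate u) y
countLetter≡mult-tabulate {zero} u y = refl
countLetter≡mult-tabulate {suc n} u y = cong (indicator ⌊ u Fin.zero ≟ y ⌋ +_) (countLetter≡mult-tabulate (u ∘ Fin.suc) y)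

mult-map-suc-suc : ∀ xs y → mult (List.map suc xs) (suc y) ≡ mult xs y
mult-map-suc-suc [] y = refl
mult-map-suc-suc (a ∷ xs) y = cong₂ _+_ (cong indicator suc≟suc) (mult-map-suc-suc xs y)
  where
  suc≟suc : ⌊ suc a ≟ suc y ⌋ ≡ ⌊ a ≟ y ⌋
  suc≟suc with a ≟ y | suc a ≟ suc y
  ... | yes _ | yes _ = refl
  ... | no _ | no _ = refl
  ... | yes a≡y | no 1+a≢1+y = ⊥-elim (1+a≢1+y (cong suc a≡y))
  ... | no a≢y | yes 1+a≡1+y = ⊥-elim (a≢y (suc-injective 1+a≡1+y))

mult-map-suc-zero : ∀ xs → mult (List.map suc xs) 0 ≡ 0
mult-map-suc-zero [] = refl
mult-map-suc-zero (a ∷ xs) = mult-map-suc-zero xs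

mult-head : ∀ a xs → 1 ≤ mult (a ∷ xs) a
mult-head a xs with a ≟ a
... | yes _ = s≤s z≤n
... | no a≢a = ⊥-elim (a≢a refl)

mult-below-head : ∀ b xs y → Sorted (b ∷ xs) → y < b → mult (b ∷ xs) y ≡ 0
mult-below-head b xs y sorted y<b with b ≟ y
... | yes refl = ⊥-elim (<-irrefl refl y<b)
mult-below-head b [] y sorted y<b | no _ = refl
mult-below-head b (c ∷ xs) y (b≤c ∷ sorted) y<b | no _ = mult-below-head c xs y sorted (<-≤-trans y<b b≤c)

sorted-mult⇒≡ : ∀ xs ys → Sorted xs → Sorted ys → (∀ y → mult xs y ≡ mult ys y) → xs ≡ ys
sorted-mult⇒≡ [] [] _ _ _ = refl
sorted-mult⇒≡ [] (b ∷ ys) _ _ same with () ← ≤-trans (mult-head b ys) (≤-reflexive (sym (same b)))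
sorted-mult⇒≡ (a ∷ xs) [] _ _ same with () ← ≤-trans (mult-head a xs) (≤-reflexive (same a))
sorted-mult⇒≡ (a ∷ xs) (b ∷ ys) sxs sys same with <-cmp a b
... | tri< a<b _ _ with () ← ≤-trans (mult-head a xs) (≤-reflexive (trans (same a) (mult-below-head b ys a sys a<b)))
... | tri> _ _ b<a with () ← ≤-trans (mult-head b ys) (≤-reflexive (trans (sym (same b)) (mult-below-head a xs b sxs b<a)))
... | tri≈ _ refl _ = cong (a ∷_) (sorted-mult⇒≡ xs ys (Linked.tail sxs) (Linked.tail sys)
                                      (λ y → +-cancelˡ-≡ (indicator ⌊ a ≟ y ⌋) _ _ (same y)))

raiseAfter : ℕ → List ℕ → List ℕ
raiseAfter zero xs = List.map suc xs
raiseAfter (suc r) [] = []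
raiseAfter (suc r) (a ∷ xs) = a ∷ raiseAfter r xs

raiseAfter-take-drop : ∀ r xs → raiseAfter r xs ≡ take r xs ++ List.map suc (drop r xs)
raiseAfter-take-drop zero xs = refl
raiseAfter-take-drop (suc r) [] = refl
raiseAfter-take-drop (suc r) (a ∷ xs) = cong (a ∷_) (raiseAfter-take-drop r xs)

raiseAfter-map-suc : ∀ r xs → raiseAfter r (List.map suc xs) ≡ List.map suc (raiseAfter r xs)
raiseAfter-map-suc zero xs = refl
raiseAfter-map-suc (suc r) [] = refl
raiseAfter-map-suc (suc r) (a ∷ xs) = cong (suc a ∷_) (raiseAfter-map-suc r xs)

raiseAfter-comm : ∀ r s xs → raiseAfter r (raiseAfter s xs) ≡ raiseAfter s (raiseAfter r xs)
raiseAfter-comm zero s xs = sym (raiseAfter-map-suc s xs)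
raiseAfter-comm (suc r) zero xs = raiseAfter-map-suc (suc r) xs
raiseAfter-comm (suc r) (suc s) [] = refl
raiseAfter-comm (suc r) (suc s) (a ∷ xs) = cong (a ∷_) (raiseAfter-comm r s xs)

sorted-map-suc : ∀ {xs} → Sorted xs → Sorted (List.map suc xs)
sorted-map-suc sorted = Linkedₚ.map⁺ (Linked.map s≤s sorted)

sorted-∷-raiseAfter : ∀ a xs r → Sorted (a ∷ xs) → Sorted (a ∷ raiseAfter r xs)
sorted-∷-raiseAfter a [] zero _ = [-]
sorted-∷-raiseAfter a [] (suc r) _ = [-]
sorted-∷-raiseAfter a (b ∷ xs) zero (a≤b ∷ sorted) = ≤-trans a≤b (n≤1+n b) ∷ sorted-map-suc sorted
sorted-∷-raiseAfter a (b ∷ xs) (suc r) (a≤b ∷ sorted) = a≤b ∷ sorted-∷-raiseAfter b xs r sorted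

sorted-raiseAfter : ∀ r xs → Sorted xs → Sorted (raiseAfter r xs)
sorted-raiseAfter zero xs sorted = sorted-map-suc sorted
sorted-raiseAfter (suc r) [] sorted = []
sorted-raiseAfter (suc r) (a ∷ xs) sorted = sorted-∷-raiseAfter a xs r sorted

SortedLetters : {n : ℕ} → Word n → List ℕ → Set
SortedLetters u xs = Sorted xs × (∀ y → countLetter u y ≡ mult xs y)

applyQueue-countLetter-raiseAfter : ∀ {n} (q : Subset n) (u : Word n) ord → length ord ≡ n → ∀ y →
  countLetter (applyQueue q u ord) y ≡ mult (raiseAfter (size q) (List.map u ord)) y
applyQueue-countLetter-raiseAfter q u ord |ord| y = begin
  countLetter (applyQueue q u ord) y
    ≡⟨ applyQueue-countLetter q u ord |ord| y ⟩
  mult (List.map (suc ∘ u) (reverse (drop r ord))) y + mult (List.map u (take r ord)) y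
    ≡⟨ cong (_+ mult (List.map u (take r ord)) y) (mult-↭ (↭ₚ.map⁺ (suc ∘ u) (↭ₚ.↭-reverse (drop r ord))) y) ⟩
  mult (List.map (suc ∘ u) (drop r ord)) y + mult (List.map u (take r ord)) y
    ≡⟨ cong₂ (λ as bs → mult as y + mult bs y)
             (trans (map-∘ (drop r ord)) (cong (List.map suc) (sym (drop-map r ord))))
             (sym (take-map r ord)) ⟩
  mult (List.map suc (drop r letters)) y + mult (take r letters) y
    ≡⟨ +-comm (mult (List.map suc (drop r letters)) y) _ ⟩
  mult (take r letters) y + mult (List.map suc (drop r letters)) y
    ≡⟨ sym (mult-++ (take r letters) _ y) ⟩
  mult (take r letters ++ List.map suc (drop r letters)) y
    ≡⟨ cong (λ zs → mult zs y) (sym (raiseAfter-take-drop r letters)) ⟩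
  mult (raiseAfter r letters) y ∎
  where
  open ≡-Reasoning
  r = size q
  letters = List.map u ord

applyQueue-sortedLetters : ∀ {n} (q : Subset n) (u : Word n) ord xs → ValidOrder u ord →
  SortedLetters u xs → SortedLetters (applyQueue q u ord) (raiseAfter (size q) xs)
applyQueue-sortedLetters {n} q u ord xs (ord↭sites , ord-sorted) (xs-sorted , u≈xs) =
  sorted-raiseAfter (size q) xs xs-sorted , λ y →
    trans (applyQueue-countLetter-raiseAfter q u ord |ord| y) (cong (λ zs → mult (raiseAfter (size q) zs) y) letters≡xs)
  where
  open ≡-Reasoning
  |ord| : length ord ≡ n
  |ord| = trans (↭ₚ.↭-length ord↭sites) (length-tabulate (λ i → i))
  letters≡xs : List.map u ord ≡ xs
  letters≡xs = sorted-mult⇒≡ (List.map u ord) xs (Linkedₚ.map⁺ ord-sorted) xs-sorted λ y → begin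
    mult (List.map u ord) y                  ≡⟨ mult-↭ (↭ₚ.map⁺ u ord↭sites) y ⟩
    mult (List.map u (List.allFin n)) y      ≡⟨ cong (λ zs → mult zs y) (map-tabulate (λ i → i) u) ⟩
    mult (tabulate u) y                      ≡⟨ sym (countLetter≡mult-tabulate u y) ⟩
    countLetter u y                          ≡⟨ u≈xs y ⟩
    mult xs y                                ∎

raiseAfterAll : List ℕ → List ℕ → List ℕ
raiseAfterAll [] xs = xs
raiseAfterAll (r ∷ rs) xs = raiseAfterAll rs (raiseAfter r xs)

run-sortedLetters : ∀ {n} {qs : List (Subset n)} {u w} → Run qs u w →
  ∀ xs → SortedLetters u xs → SortedLetters w (raiseAfterAll (List.map size qs) xs)
run-sortedLetters done xs u≈xs = u≈xs
run-sortedLetters (step {q = q} {u = u} ord valid run) xs u≈xs =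
  run-sortedLetters run (raiseAfter (size q) xs) (applyQueue-sortedLetters q u ord xs valid u≈xs)

raiseAfterAll-↭ : ∀ {rs ss} → rs ↭ ss → ∀ xs → raiseAfterAll rs xs ≡ raiseAfterAll ss xs
raiseAfterAll-↭ ↭.refl xs = refl
raiseAfterAll-↭ (prep r rs↭ss) xs = raiseAfterAll-↭ rs↭ss (raiseAfter r xs)
raiseAfterAll-↭ (swap {ys = ss} r s rs↭ss) xs =
  trans (raiseAfterAll-↭ rs↭ss (raiseAfter s (raiseAfter r xs))) (cong (raiseAfterAll ss) (raiseAfter-comm s r xs))
raiseAfterAll-↭ (↭.trans rs↭ss ss↭ts) xs = trans (raiseAfterAll-↭ rs↭ss xs) (raiseAfterAll-↭ ss↭ts xs)

replicate-+ : ∀ c d (a : ℕ) → replicate (c + d) a ≡ replicate c a ++ replicate d a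
replicate-+ zero d a = refl
replicate-+ (suc c) d a = cong (a ∷_) (replicate-+ c d a)

raiseAfter-replicate : ∀ c s a xs → raiseAfter (c + s) (replicate c a ++ xs) ≡ replicate c a ++ raiseAfter s xs
raiseAfter-replicate zero s a xs = refl
raiseAfter-replicate (suc c) s a xs = cong (a ∷_) (raiseAfter-replicate c s a xs)

raiseAfterAll-replicate : ∀ c rs a xs →
  raiseAfterAll (List.map (c +_) rs) (replicate c a ++ xs) ≡ replicate c a ++ raiseAfterAll rs xs
raiseAfterAll-replicate c [] a xs = refl
raiseAfterAll-replicate c (r ∷ rs) a xs =
  trans (cong (raiseAfterAll (List.map (c +_) rs)) (raiseAfter-replicate c r a xs))
        (raiseAfterAll-replicate c rs a (raiseAfter r xs))

raiseAfterAll-map-suc : ∀ rs xs → raiseAfterAll rs (List.map suc xs) ≡ List.map suc (raiseAfterAll rs xs)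
raiseAfterAll-map-suc [] xs = refl
raiseAfterAll-map-suc (r ∷ rs) xs =
  trans (cong (raiseAfterAll rs) (raiseAfter-map-suc r xs)) (raiseAfterAll-map-suc rs (raiseAfter r xs))

typeWord : {ℓ : ℕ} → Vec ℕ ℓ → List ℕ
typeWord Vec.[] = []
typeWord (c Vec.∷ m) = replicate c 1 ++ List.map suc (typeWord m)

partialSums : {k : ℕ} → Vec ℕ (suc k) → List ℕ
partialSums {k} m = tabulate (λ (j : Fin k) → p (suc (toℕ j)) m)

raiseAfterAll-partialSums : ∀ {k} (m : Vec ℕ (suc k)) →
  raiseAfterAll (partialSums m) (replicate (p (suc k) m) 1) ≡ typeWord m
raiseAfterAll-partialSums (c Vec.∷ Vec.[]) = trans (cong (λ d → replicate d 1) (+-identityʳ c)) (sym (++-identityʳ _))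
raiseAfterAll-partialSums {suc k} (c Vec.∷ m) = begin
  raiseAfterAll (c + 0 ∷ tabulate (λ (j : Fin k) → c + p (suc (toℕ j)) m)) (replicate (c + P) 1)
    ≡⟨ cong₂ (λ rs zs → raiseAfterAll rs (raiseAfter (c + 0) zs))
             (sym (map-tabulate {n = k} (λ j → p (suc (toℕ j)) m) (c +_))) (replicate-+ c P 1) ⟩
  raiseAfterAll (List.map (c +_) (partialSums m)) (raiseAfter (c + 0) (replicate c 1 ++ replicate P 1))
    ≡⟨ cong (raiseAfterAll (List.map (c +_) (partialSums m))) (raiseAfter-replicate c 0 1 (replicate P 1)) ⟩
  raiseAfterAll (List.map (c +_) (partialSums m)) (replicate c 1 ++ List.map suc (replicate P 1))
    ≡⟨ raiseAfterAll-replicate c (partialSums m) 1 _ ⟩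
  replicate c 1 ++ raiseAfterAll (partialSums m) (List.map suc (replicate P 1))
    ≡⟨ cong (replicate c 1 ++_) (raiseAfterAll-map-suc (partialSums m) (replicate P 1)) ⟩
  replicate c 1 ++ List.map suc (raiseAfterAll (partialSums m) (replicate P 1))
    ≡⟨ cong (λ zs → replicate c 1 ++ List.map suc zs) (raiseAfterAll-partialSums m) ⟩
  typeWord (c Vec.∷ m) ∎
  where
  open ≡-Reasoning
  P = p (suc k) m

mult-replicate : ∀ c a y → mult (replicate c a) y ≡ c * indicator ⌊ a ≟ y ⌋
mult-replicate zero a y = refl
mult-replicate (suc c) a y = cong (indicator ⌊ a ≟ y ⌋ +_) (mult-replicate c a y)

mult-typeWord-zero : ∀ {ℓ} (m : Vec ℕ ℓ) → mult (typeWord m) 0 ≡ 0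
mult-typeWord-zero Vec.[] = refl
mult-typeWord-zero (c Vec.∷ m) = begin
  mult (replicate c 1 ++ List.map suc (typeWord m)) 0          ≡⟨ mult-++ (replicate c 1) _ 0 ⟩
  mult (replicate c 1) 0 + mult (List.map suc (typeWord m)) 0  ≡⟨ cong₂ _+_ (trans (mult-replicate c 1 0) (*-zeroʳ c))
                                                                            (mult-map-suc-zero (typeWord m)) ⟩
  0                                                            ∎
  where open ≡-Reasoning

mult-typeWord : ∀ {ℓ} (m : Vec ℕ ℓ) y → 1 ≤ y → mult (typeWord m) y ≡ extType m y
mult-typeWord Vec.[] (suc y) _ = refl
mult-typeWord (c Vec.∷ m) (suc y) _ = begin
  mult (replicate c 1 ++ List.map suc (typeWord m)) (suc y)              ≡⟨ mult-++ (replicate c 1) _ (suc y) ⟩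
  mult (replicate c 1) (suc y) + mult (List.map suc (typeWord m)) (suc y) ≡⟨ cong₂ _+_ (mult-replicate c 1 (suc y))
                                                                                      (mult-map-suc-suc (typeWord m) y) ⟩
  c * indicator ⌊ 1 ≟ suc y ⌋ + mult (typeWord m) y                      ≡⟨ by-letter y ⟩
  extType (c Vec.∷ m) (suc y)                                            ∎
  where
  open ≡-Reasoning
  by-letter : ∀ y → c * indicator ⌊ 1 ≟ suc y ⌋ + mult (typeWord m) y ≡ extType (c Vec.∷ m) (suc y)
  by-letter zero = trans (cong₂ _+_ (*-identityʳ c) (mult-typeWord-zero m)) (+-identityʳ c)
  by-letter (suc y) = trans (cong (_+ mult (typeWord m) (suc y)) (*-zeroʳ c)) (mult-typeWord m (suc y) (s≤s z≤n))

module ListConcat = MonoidSum (↭ₚ.++-commutativeMonoid {A = ℕ})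

concat-singletons : ∀ {k} (f : Fin k → ℕ) → ListConcat.sum (λ j → f j ∷ []) ≡ tabulate f
concat-singletons {zero} f = refl
concat-singletons {suc k} f = cong (f Fin.zero ∷_) (concat-singletons (f ∘ Fin.suc))

tabulate-permute : ∀ {k} (f : Fin k → ℕ) (σ : Permutation′ k) → tabulate f ↭ tabulate (f ∘ (σ ⟨$⟩ʳ_))
tabulate-permute f σ =
  subst₂ _↭_ (concat-singletons f) (concat-singletons (f ∘ (σ ⟨$⟩ʳ_))) (ListConcat.sum-permute (λ j → f j ∷ []) σ)

map-size-toList : ∀ {n k} (q : Vec (Subset n) k) → List.map size (toList q) ≡ tabulate (size ∘ lookup q)
map-size-toList Vec.[] = refl
map-size-toList (x Vec.∷ q) = cong (size x ∷_) (map-size-toList q)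

sortedLetters-ones : ∀ n → SortedLetters (ones n) (replicate n 1)
sortedLetters-ones n = all-ones n , λ y → trans (countLetter≡mult-tabulate (ones n) y) (cong (λ zs → mult zs y) (tabulate-ones n))
  where
  all-ones : ∀ n → Sorted (replicate n 1)
  all-ones zero = []
  all-ones (suc zero) = [-]
  all-ones (suc (suc n)) = ≤-refl ∷ all-ones (suc n)
  tabulate-ones : ∀ n → tabulate (ones n) ≡ replicate n 1
  tabulate-ones zero = refl
  tabulate-ones (suc n) = cong (1 ∷_) (tabulate-ones n)

lemma2p12 : (n : ℕ) → 1 ≤ n → (ℓ : ℕ) → 1 ≤ ℓ →
    (σ : Permutation′ (ℓ ∸ 1)) (m : Vec ℕ ℓ) → p ℓ m ≡ n →
    (q : Vec (Subset n) (ℓ ∸ 1)) →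
    (∀ i → size (lookup q i) ≡ p (suc (toℕ (σ ⟨$⟩ʳ i))) m) →
    (w : Word n) → Run (toList q) (ones n) w → HasType w m
lemma2p12 n _ (suc k) _ σ m p[m]≡n q |q| w run y 1≤y = begin
  countLetter w y                                                ≡⟨ proj₂ (run-sortedLetters run _ (sortedLetters-ones n)) y ⟩
  mult (raiseAfterAll (List.map size (toList q)) (replicate n 1)) y ≡⟨ cong (λ zs → mult zs y) queues-raise-type ⟩
  mult (typeWord m) y                                            ≡⟨ mult-typeWord m y 1≤y ⟩
  extType m y                                                    ∎
  where
  open ≡-Reasoning
  queues-raise-type : raiseAfterAll (List.map size (toList q)) (replicate n 1) ≡ typeWord m
  queues-raise-type = begin
    raiseAfterAll (List.map size (toList q)) (replicate n 1)
      ≡⟨ cong (λ rs → raiseAfterAll rs (replicate n 1)) (trans (map-size-toList q) (tabulate-cong |q|)) ⟩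
    raiseAfterAll (tabulate (λ i → p (suc (toℕ (σ ⟨$⟩ʳ i))) m)) (replicate n 1)
      ≡⟨ raiseAfterAll-↭ (↭-sym (tabulate-permute (λ j → p (suc (toℕ j)) m) σ)) _ ⟩
    raiseAfterAll (partialSums m) (replicate n 1)
      ≡⟨ cong (λ c → raiseAfterAll (partialSums m) (replicate c 1)) (sym p[m]≡n) ⟩
    raiseAfterAll (partialSums m) (replicate (p (suc k) m) 1)
      ≡⟨ raiseAfterAll-partialSums m ⟩
    typeWord m ∎
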